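{- Let $n$ and $m$ be positive integers with $m\geq n+1$. There is a bijection from $\tilde{\mathcal{L}}_{n,m,0}$ onto $\mathcal{M}_{n,m,1}$.
   Context: An $(n,m)$-lattice path is a sequence $P=(x_1,y_1)(x_2,y_2)\cdots(x_{n+1},y_{n+1})$ of vectors in $\mathbb{Z}^2$ such that $1-n\leq y_i\leq 1$ for all $i$, $\sum_{i=1}^{n+1}y_i=1$, $1\leq x_i\leq m-1$ for all $i$, and $\sum_{i=1}^{n+1}x_i=m$. For such $P$, let $NP(P)=\{i\in\{1,\ldots,n+1\}\mid \sum_{j=1}^{i}y_j\leq 0\}$ and $NPL(P)=\sum_{i\in NP(P)}x_i$. Let $\tilde{\mathcal{L}}_{n,m,0}$ be the set of all $(n,m)$-lattice paths $P$ with $NPL(P)=0$ and $x_{n+1}=1$. Also put $a_0=b_0=0$, $a_i=\sum_{j=1}^{i}y_j$ and $b_i=\sum_{j=1}^{i}x_j$ for $1\leq i\leq n+1$, and view $P$ as the sequence of points $(b_0,a_0),\ldots,(b_{n+1},a_{n+1})$. A minimum point of $P$ is a point $(b_i,a_i)$ with $a_i\leq a_j$ for all $j\in\{0,\ldots,n+1\}$; the rightmost minimum point is the minimum point with the largest $b_i$. If $(b_i,a_i)$ is the rightmost minimum point, $RML(P)=b_i$ is the rightmost minimum length. $\mathcal{M}_{n,m,1}$ denotes the set of all $(n,m)$-lattice paths $P$ with $RML(P)=1$. -}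

module Defs where

open import Data.Nat as ℕ using (ℕ; zero; suc)
open import Data.Integer as ℤ using (ℤ; +_)
open import Data.Bool using (Bool; true; false; if_then_else_)
open import Data.Product using (Σ; _×_; _,_; proj₁; proj₂)
open import Data.List using (List; []; _∷_; length; last)
open import Data.List.Relation.Unary.All using (All)
open import Data.List.Membership.Propositional using (_∈_)
open import Data.Maybe using (just)
open import Relation.Binary.PropositionalEquality using (_≡_)
open import Relation.Binary.Bundles using (Setoid)
import Relation.Binary.PropositionalEquality as PE
open import Function.Bundles using (Bijection)

Step : Set
Step = ℕ × ℤ

sumX : List Step → ℕ
sumX [] = 0
sumX ((x , _) ∷ s) = x ℕ.+ sumX s

sumY : List Step → ℤ
sumY [] = + 0
sumY ((_ , y) ∷ s) = y ℤ.+ sumY s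

StepOK : ℕ → ℕ → Step → Set
StepOK n m (x , y) =
  ((+ 1 ℤ.- + n) ℤ.≤ y × y ℤ.≤ + 1) × (1 ℕ.≤ x × x ℕ.≤ m ℕ.∸ 1)

IsLatticePath : ℕ → ℕ → List Step → Set
IsLatticePath n m P =
  length P ≡ suc n × All (StepOK n m) P × sumY P ≡ + 1 × sumX P ≡ m

-- NPL(P) = Σ_{i ∈ NP(P)} x_i, NP(P) = { i | a_i = y_1+...+y_i ≤ 0 }.
-- nplFrom a s : contribution of the remaining steps s when the current
-- partial sum (height before these steps) is a.
nplFrom : ℤ → List Step → ℕ
nplFrom a [] = 0
nplFrom a ((x , y) ∷ s) =
  (if (a ℤ.+ y) ℤ.≤ᵇ + 0 then x else 0) ℕ.+ nplFrom (a ℤ.+ y) s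

NPL : List Step → ℕ
NPL P = nplFrom (+ 0) P

pointsFrom : ℕ → ℤ → List Step → List (ℕ × ℤ)
pointsFrom b a [] = []
pointsFrom b a ((x , y) ∷ s) = (b ℕ.+ x , a ℤ.+ y) ∷ pointsFrom (b ℕ.+ x) (a ℤ.+ y) s

points : List Step → List (ℕ × ℤ)
points P = (0 , + 0) ∷ pointsFrom 0 (+ 0) P

IsMinPoint : List Step → ℕ × ℤ → Set
IsMinPoint P p = p ∈ points P × (∀ {q} → q ∈ points P → proj₂ p ℤ.≤ proj₂ q)

IsRightmostMinPoint : List Step → ℕ × ℤ → Set
IsRightmostMinPoint P p =
  IsMinPoint P p × (∀ {q} → IsMinPoint P q → proj₁ q ℕ.≤ proj₁ p)

RMLIs : List Step → ℕ → Set
RMLIs P r = Σ (ℕ × ℤ) λ p → IsRightmostMinPoint P p × proj₁ p ≡ r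

record Ltilde0 (n m : ℕ) : Set where
  constructor mkL
  field
    path      : List Step
    isPath    : IsLatticePath n m path
    nplZero   : NPL path ≡ 0
    lastX1    : Data.Maybe.map proj₁ (last path) ≡ just 1

record M1 (n m : ℕ) : Set where
  constructor mkM
  field
    path   : List Step
    isPath : IsLatticePath n m path
    rml1   : RMLIs path 1

-- Sets are compared by their underlying paths (membership proofs ignored).
Ltilde0-setoid : ℕ → ℕ → Setoid _ _
Ltilde0-setoid n m = record
  { Carrier = Ltilde0 n m
  ; _≈_ = λ P Q → Ltilde0.path P ≡ Ltilde0.path Q
  ; isEquivalence = record { refl = PE.refl ; sym = PE.sym ; trans = PE.trans } }

M1-setoid : ℕ → ℕ → Setoid _ _
M1-setoid n m = record
  { Carrier = M1 n m
  ; _≈_ = λ P Q → M1.path P ≡ M1.path Q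
  ; isEquivalence = record { refl = PE.refl ; sym = PE.sym ; trans = PE.trans } }

module Submission where

-- The bijection moves the last step, of width 1, to the front. NPL(P) = 0 says that every
-- point of P after the origin lies strictly above height 0. Moving the final step (1 , y)
-- to the front shifts the heights of the other points by y, so the end (1 , y) of the new
-- first step lies strictly below all later points; and it is not above the origin, since
-- y = 1 - (height reached before the last step) ≤ 0. Hence it is the rightmost minimum, at
-- abscissa 1. Conversely, abscissae increase strictly, so a rightmost minimum at abscissa 1
-- is the end of a first step of width 1 with every later point strictly above it, and
-- rotating this step to the end gives a path whose points after the origin are all positive.

open import Defs
open import Data.Nat as ℕ using (ℕ; suc; _≤_; z≤n; s≤s)
open import Function.Bundles using (Bijection)
import Data.Nat.Properties as ℕ
open import Data.Integer as ℤ using (ℤ; +_)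
import Data.Integer.Properties as ℤ
import Algebra.Properties.CommutativeSemigroup as CommutativeSemigroup
open import Data.Bool using (true; false; T)
open import Data.Product using (_×_; _,_; proj₁; proj₂)
open import Data.List using (List; []; _∷_; _∷ʳ_; map; length; last; initLast; _∷ʳ′_)
import Data.List.Properties as List
open import Data.List.Relation.Unary.All as All using (All; []; _∷_)
import Data.List.Relation.Unary.All.Properties as All
open import Data.List.Relation.Unary.Any using (here; there)
open import Data.List.Membership.Propositional using (_∈_)
open import Data.Maybe as Maybe using (just)
open import Data.Empty using (⊥-elim)
open import Data.Unit using (tt)
open import Function.Properties.Inverse using (Inverse⇒Bijection)
open import Relation.Binary.PropositionalEquality

module _ {a} {A : Set a} where

  rotateˡ : List A → List A
  rotateˡ []       = []
  rotateˡ (x ∷ xs) = xs ∷ʳ x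

  rotateʳ : List A → List A
  rotateʳ []       = []
  rotateʳ (x ∷ xs) with rotateʳ xs
  ... | []     = x ∷ []
  ... | y ∷ ys = y ∷ x ∷ ys

  rotateʳ-∷ʳ : ∀ xs (x : A) → rotateʳ (xs ∷ʳ x) ≡ x ∷ xs
  rotateʳ-∷ʳ []       x = refl
  rotateʳ-∷ʳ (y ∷ xs) x rewrite rotateʳ-∷ʳ xs x = refl

  rotateʳ-rotateˡ : ∀ xs → rotateʳ (rotateˡ xs) ≡ xs
  rotateʳ-rotateˡ []       = refl
  rotateʳ-rotateˡ (x ∷ xs) = rotateʳ-∷ʳ xs x

  rotateˡ-rotateʳ : ∀ xs → rotateˡ (rotateʳ xs) ≡ xs
  rotateˡ-rotateʳ xs with initLast xs
  ... | []       = refl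
  ... | ys ∷ʳ′ y rewrite rotateʳ-∷ʳ ys y = refl

  last-∷ʳ : ∀ xs (x : A) → last (xs ∷ʳ x) ≡ just x
  last-∷ʳ []           x = refl
  last-∷ʳ (_ ∷ [])     x = refl
  last-∷ʳ (_ ∷ y ∷ xs) x = last-∷ʳ (y ∷ xs) x

  length-∷ʳ : ∀ xs (x : A) → length (xs ∷ʳ x) ≡ suc (length xs)
  length-∷ʳ xs x = trans (List.length-++ xs) (ℕ.+-comm (length xs) 1)

sumX-∷ʳ : ∀ Q s → sumX (Q ∷ʳ s) ≡ sumX (s ∷ Q)
sumX-∷ʳ []             s = refl
sumX-∷ʳ ((x' , _) ∷ Q) s@(x , _) =
  trans (cong (x' ℕ.+_) (sumX-∷ʳ Q s)) (CommutativeSemigroup.x∙yz≈y∙xz ℕ.+-commutativeSemigroup x' x (sumX Q))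

sumY-∷ʳ : ∀ Q s → sumY (Q ∷ʳ s) ≡ sumY (s ∷ Q)
sumY-∷ʳ []             s = refl
sumY-∷ʳ ((_ , y') ∷ Q) s@(_ , y) =
  trans (cong (λ t → y' ℤ.+ t) (sumY-∷ʳ Q s)) (CommutativeSemigroup.x∙yz≈y∙xz ℤ.+-commutativeSemigroup y' y (sumY Q))

isLatticePath-rotateʳ : ∀ {n m} Q s → IsLatticePath n m (Q ∷ʳ s) → IsLatticePath n m (s ∷ Q)
isLatticePath-rotateʳ Q s (len , ok , ∑y , ∑x) =
  let okQ , okS = All.∷ʳ⁻ ok in
  trans (sym (length-∷ʳ Q s)) len , okS ∷ okQ ,
  trans (sym (sumY-∷ʳ Q s)) ∑y , trans (sym (sumX-∷ʳ Q s)) ∑x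

isLatticePath-rotateˡ : ∀ {n m} Q s → IsLatticePath n m (s ∷ Q) → IsLatticePath n m (Q ∷ʳ s)
isLatticePath-rotateˡ Q s (len , okS ∷ okQ , ∑y , ∑x) =
  trans (length-∷ʳ Q s) len , All.∷ʳ⁺ okQ okS ,
  trans (sumY-∷ʳ Q s) ∑y , trans (sumX-∷ʳ Q s) ∑x

heightsFrom : ℤ → List Step → List ℤ
heightsFrom a []            = []
heightsFrom a ((_ , y) ∷ Q) = a ℤ.+ y ∷ heightsFrom (a ℤ.+ y) Q

map-proj₂-pointsFrom : ∀ b a Q → map proj₂ (pointsFrom b a Q) ≡ heightsFrom a Q
map-proj₂-pointsFrom b a []            = refl
map-proj₂-pointsFrom b a ((x , y) ∷ Q) = cong (a ℤ.+ y ∷_) (map-proj₂-pointsFrom (b ℕ.+ x) (a ℤ.+ y) Q)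

module _ {p} {P : ℤ → Set p} where

  heightsFrom-lookup : ∀ {b a Q q} → All P (heightsFrom a Q) → q ∈ pointsFrom b a Q → P (proj₂ q)
  heightsFrom-lookup {b} {a} {Q} Ps =
    All.lookup (All.map⁻ (subst (All P) (sym (map-proj₂-pointsFrom b a Q)) Ps))

  heightsFrom-tabulate : ∀ {b a Q} → (∀ {q} → q ∈ pointsFrom b a Q → P (proj₂ q)) → All P (heightsFrom a Q)
  heightsFrom-tabulate {b} {a} {Q} f =
    subst (All P) (map-proj₂-pointsFrom b a Q) (All.map⁺ (All.tabulate f))

heightsFrom-+ : ∀ a d Q → heightsFrom (a ℤ.+ d) Q ≡ map (ℤ._+ d) (heightsFrom a Q)
heightsFrom-+ a d []            = refl
heightsFrom-+ a d ((_ , y) ∷ Q) rewrite CommutativeSemigroup.xy∙z≈xz∙y ℤ.+-commutativeSemigroup a d y =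
  cong ((a ℤ.+ y) ℤ.+ d ∷_) (heightsFrom-+ (a ℤ.+ y) d Q)

above-+ : ∀ {h a} d Q → All (h ℤ.<_) (heightsFrom a Q) → All (h ℤ.+ d ℤ.<_) (heightsFrom (a ℤ.+ d) Q)
above-+ {a = a} d Q above rewrite heightsFrom-+ a d Q = All.map⁺ (All.map (ℤ.+-monoˡ-< d) above)

heightsFrom-∷ʳ : ∀ a Q s → heightsFrom a (Q ∷ʳ s) ≡ heightsFrom a Q ∷ʳ (a ℤ.+ sumY (Q ∷ʳ s))
heightsFrom-∷ʳ a []             (_ , y) = cong (λ t → a ℤ.+ t ∷ []) (sym (ℤ.+-identityʳ y))
heightsFrom-∷ʳ a ((_ , y) ∷ Q) s =
  cong (a ℤ.+ y ∷_) (trans (heightsFrom-∷ʳ (a ℤ.+ y) Q s)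
                           (cong (heightsFrom (a ℤ.+ y) Q ∷ʳ_) (ℤ.+-assoc a y (sumY (Q ∷ʳ s)))))

sumY∈heightsFrom : ∀ a q Q → a ℤ.+ sumY (q ∷ Q) ∈ heightsFrom a (q ∷ Q)
sumY∈heightsFrom a (_ , y) []      = here (cong (λ t → a ℤ.+ t) (ℤ.+-identityʳ y))
sumY∈heightsFrom a (_ , y) (q ∷ Q) =
  there (subst (_∈ heightsFrom (a ℤ.+ y) (q ∷ Q)) (ℤ.+-assoc a y (sumY (q ∷ Q))) (sumY∈heightsFrom (a ℤ.+ y) q Q))

Wide : Step → Set
Wide (x , _) = 1 ≤ x

stepOK⇒wide : ∀ {n m s} → StepOK n m s → Wide s
stepOK⇒wide {s = _ , _} (_ , 1≤x , _) = 1≤x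

isLatticePath⇒wide : ∀ {n m P} → IsLatticePath n m P → All Wide P
isLatticePath⇒wide {n} {m} (_ , ok , _) = All.map (stepOK⇒wide {n} {m}) ok

pointsFrom-beyond : ∀ {b a Q q} → All Wide Q → q ∈ pointsFrom b a Q → b ℕ.< proj₁ q
pointsFrom-beyond {b} (1≤x ∷ _)    (here refl) = ℕ.m<m+n b 1≤x
pointsFrom-beyond {b} (1≤x ∷ wide) (there q∈)  = ℕ.<-trans (ℕ.m<m+n b 1≤x) (pointsFrom-beyond wide q∈)

nplFrom≡0⇒above0 : ∀ a Q → All Wide Q → nplFrom a Q ≡ 0 → All (+ 0 ℤ.<_) (heightsFrom a Q)
nplFrom≡0⇒above0 a []            []           _   = []
nplFrom≡0⇒above0 a ((x , y) ∷ Q) (1≤x ∷ wide) npl with (a ℤ.+ y) ℤ.≤ᵇ + 0 in ≤ᵇ≡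
... | true  = ⊥-elim (ℕ.<⇒≱ 1≤x (ℕ.≤-reflexive (ℕ.m+n≡0⇒m≡0 x npl)))
... | false = ℤ.≰⇒> (λ ≤0 → subst T ≤ᵇ≡ (ℤ.≤⇒≤ᵇ ≤0)) ∷ nplFrom≡0⇒above0 (a ℤ.+ y) Q wide npl

above0⇒nplFrom≡0 : ∀ a Q → All (+ 0 ℤ.<_) (heightsFrom a Q) → nplFrom a Q ≡ 0
above0⇒nplFrom≡0 a []            []           = refl
above0⇒nplFrom≡0 a ((x , y) ∷ Q) (0< ∷ above) with (a ℤ.+ y) ℤ.≤ᵇ + 0 in ≤ᵇ≡
... | true  = ⊥-elim (ℤ.<⇒≱ 0< (ℤ.≤ᵇ⇒≤ (subst T (sym ≤ᵇ≡) tt)))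
... | false = above0⇒nplFrom≡0 (a ℤ.+ y) Q above

-- The first point is kept at height + 0 ℤ.+ y, as produced by points; it is not definitionally y.
rml≡1⇒firstStepLowest : ∀ {x y Q} → 1 ≤ x → All Wide Q → RMLIs ((x , y) ∷ Q) 1 →
         x ≡ 1 × All (+ 0 ℤ.+ y ℤ.<_) (heightsFrom (+ 0 ℤ.+ y) Q)
rml≡1⇒firstStepLowest _ _ (_ , ((here refl , _) , _) , ())
rml≡1⇒firstStepLowest 1≤x wide (_ , ((there (there q∈) , _) , _) , refl) =
  ⊥-elim (ℕ.<⇒≱ (pointsFrom-beyond wide q∈) 1≤x)
rml≡1⇒firstStepLowest {y = y} {Q} _ wide (_ , ((there (here refl) , min) , rightmost) , refl) =
  refl , heightsFrom-tabulate higher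
  where
  c = + 0 ℤ.+ y
  higher : ∀ {q} → q ∈ pointsFrom 1 c Q → c ℤ.< proj₂ q
  -- A later point at height c would be a minimum point to the right of abscissa 1.
  higher q∈ = ℤ.≤∧≢⇒< (min (there (there q∈))) λ c≡ →
    ℕ.<⇒≱ (pointsFrom-beyond wide q∈) (rightmost (there (there q∈) , λ r → subst (ℤ._≤ _) c≡ (min r)))

firstStepLowest⇒rml≡1 : ∀ {y Q} → + 0 ℤ.+ y ℤ.≤ + 0 → All (+ 0 ℤ.+ y ℤ.<_) (heightsFrom (+ 0 ℤ.+ y) Q) →
         RMLIs ((1 , y) ∷ Q) 1
firstStepLowest⇒rml≡1 {y} {Q} c≤0 above = (1 , c) , ((there (here refl) , min) , rightmost) , refl
  where
  c = + 0 ℤ.+ y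
  higher : ∀ {q} → q ∈ pointsFrom 1 c Q → c ℤ.< proj₂ q
  higher = heightsFrom-lookup above
  min : ∀ {q} → q ∈ points ((1 , y) ∷ Q) → c ℤ.≤ proj₂ q
  min (here refl)          = c≤0
  min (there (here refl))  = ℤ.≤-refl
  min (there (there q∈))   = ℤ.<⇒≤ (higher q∈)
  rightmost : ∀ {q} → IsMinPoint ((1 , y) ∷ Q) q → proj₁ q ≤ 1
  rightmost (here refl , _)          = z≤n
  rightmost (there (here refl) , _)  = ℕ.≤-refl
  rightmost (there (there q∈) , min′) = ⊥-elim (ℤ.<⇒≱ (higher q∈) (min′ (there (here refl))))

npl≡0⇒rml≡1 : ∀ {n m} → 1 ≤ n → ∀ Q y → IsLatticePath n m (Q ∷ʳ (1 , y)) → NPL (Q ∷ʳ (1 , y)) ≡ 0 →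
              RMLIs ((1 , y) ∷ Q) 1
npl≡0⇒rml≡1 (s≤s z≤n) [] y (() , _) _
npl≡0⇒rml≡1 _ Q@(q ∷ Q′) y isP npl = firstStepLowest⇒rml≡1 {y} {Q} c≤0 aboveC
  where
  c = + 0 ℤ.+ y
  above0 : All (+ 0 ℤ.<_) (heightsFrom (+ 0) Q)
  above0 = proj₁ (All.∷ʳ⁻ (subst (All _) (heightsFrom-∷ʳ (+ 0) Q (1 , y))
             (nplFrom≡0⇒above0 (+ 0) (Q ∷ʳ (1 , y)) (isLatticePath⇒wide isP) npl)))
  aboveC : All (c ℤ.<_) (heightsFrom c Q)
  aboveC = above-+ {a = + 0} y Q above0
  total : c ℤ.+ sumY Q ≡ + 1
  total = trans (ℤ.+-assoc (+ 0) y (sumY Q))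
                (cong (λ t → + 0 ℤ.+ t) (proj₁ (proj₂ (proj₂ (isLatticePath-rotateʳ Q (1 , y) isP)))))
  -- The heights of Q above c end at the total height 1, so c < 1.
  c≤0 : c ℤ.≤ + 0
  c≤0 = ℤ.i<j⇒i≤pred[j] (subst (c ℤ.<_) total (All.lookup aboveC (sumY∈heightsFrom c q Q′)))

rml≡1⇒npl≡0 : ∀ {n m} x y Q → IsLatticePath n m ((x , y) ∷ Q) → RMLIs ((x , y) ∷ Q) 1 →
              x ≡ 1 × NPL (Q ∷ʳ (x , y)) ≡ 0
rml≡1⇒npl≡0 x y Q isP rml with isLatticePath⇒wide isP
... | 1≤x ∷ wide with rml≡1⇒firstStepLowest {x} {y} {Q} 1≤x wide rml
... | refl , aboveC = refl , above0⇒nplFrom≡0 (+ 0) (Q ∷ʳ (1 , y))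
  (subst (All _) (sym (heightsFrom-∷ʳ (+ 0) Q (1 , y))) (All.∷ʳ⁺ above0 endsAt1))
  where
  c = + 0 ℤ.+ y
  above0 : All (+ 0 ℤ.<_) (heightsFrom (+ 0) Q)
  above0 = subst (λ h → All (h ℤ.<_) (heightsFrom h Q)) (ℤ.+-inverseʳ c) (above-+ (ℤ.- c) Q aboveC)
  endsAt1 : + 0 ℤ.< + 0 ℤ.+ sumY (Q ∷ʳ (1 , y))
  endsAt1 = subst (λ t → + 0 ℤ.< + 0 ℤ.+ t) (sym (proj₁ (proj₂ (proj₂ (isLatticePath-rotateˡ Q (1 , y) isP)))))
                  (ℤ.+<+ (s≤s z≤n))

rotateʳ-Ltilde0⇒M1 : ∀ {n m} → 1 ≤ n → ∀ P → IsLatticePath n m P → NPL P ≡ 0 →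
                     Maybe.map proj₁ (last P) ≡ just 1 → IsLatticePath n m (rotateʳ P) × RMLIs (rotateʳ P) 1
rotateʳ-Ltilde0⇒M1 1≤n P isP npl endsWith1 with initLast P
rotateʳ-Ltilde0⇒M1 _ .[] (() , _) _ _ | []
rotateʳ-Ltilde0⇒M1 1≤n .(Q ∷ʳ (x , y)) isP npl endsWith1 | Q ∷ʳ′ (x , y)
  rewrite rotateʳ-∷ʳ Q (x , y) | last-∷ʳ Q (x , y) with endsWith1
... | refl = isLatticePath-rotateʳ Q (1 , y) isP , npl≡0⇒rml≡1 1≤n Q y isP npl

rotateˡ-M1⇒Ltilde0 : ∀ {n m} P → IsLatticePath n m P → RMLIs P 1 →
                     IsLatticePath n m (rotateˡ P) × NPL (rotateˡ P) ≡ 0 × Maybe.map proj₁ (last (rotateˡ P)) ≡ just 1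
rotateˡ-M1⇒Ltilde0 []            (() , _) _
rotateˡ-M1⇒Ltilde0 ((x , y) ∷ Q) isP rml with rml≡1⇒npl≡0 x y Q isP rml
... | refl , npl = isLatticePath-rotateˡ Q (1 , y) isP , npl , cong (Maybe.map proj₁) (last-∷ʳ Q (1 , y))

lemma2p11 : (n m : ℕ) → 1 ≤ n → suc n ≤ m →
    Bijection (Ltilde0-setoid n m) (M1-setoid n m)
lemma2p11 n m 1≤n _ = Inverse⇒Bijection record
  { to        = to
  ; from      = from
  ; to-cong   = cong rotateʳ
  ; from-cong = cong rotateˡ
  ; inverse   = (λ {B} eq → trans (cong rotateʳ eq) (rotateʳ-rotateˡ (M1.path B)))
              , (λ {A} eq → trans (cong rotateˡ eq) (rotateˡ-rotateʳ (Ltilde0.path A)))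
  }
  where
  to : Ltilde0 n m → M1 n m
  to (mkL P isP npl endsWith1) =
    let isP′ , rml = rotateʳ-Ltilde0⇒M1 1≤n P isP npl endsWith1 in mkM (rotateʳ P) isP′ rml
  from : M1 n m → Ltilde0 n m
  from (mkM P isP rml) =
    let isP′ , npl , endsWith1 = rotateˡ-M1⇒Ltilde0 P isP rml in mkL (rotateˡ P) isP′ npl endsWith1
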